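{- Let $\mathrm{nil}\colon\mathbb{L}\to\mathbb{L}$ be a function preserving $\prec$ with behavior $\mathrm{nil}$ on $\mathbb{L}$. Let $(x_1,\dots,x_k),(y_1,\dots,y_k)$ both satisfy $\mathrm{Nil}$, and let $\delta$ be a permutation of $\{1,\dots,k\}$. Then there exists $e\in\langle\mathrm{Aut}(\mathbb{L};C)\cup\{\mathrm{nil}\}\rangle$ such that $e(x_i)=y_{\delta(i)}$ for all $i\in\{1,\dots,k\}$.
   Context: A finite rooted binary tree is a finite rooted tree in which every non-leaf vertex has exactly two children; its leaf structure is the structure on its set of leaves with the ternary relation $C$ where $C(x;yz)$ holds iff the youngest common ancestor of $y$ and $z$ is a proper descendant of the youngest common ancestor of $x,y,z$ (so $C(x;yy)$ holds whenever $x\neq y$). $(\mathbb{L};C)$ denotes the unique (up to isomorphism) countable homogeneous structure whose finite substructures are, up to isomorphism, exactly the leaf structures of finite rooted binary trees. We write $xy|z$ for $C(z;xy)$, and $a_1\dots a_m|b$ means $a_ia_j|b$ for all $i,j$. $\prec$ is a fixed linear order on $\mathbb{L}$ that is convex (whenever $xy|z$, $z$ does not lie strictly between $x$ and $y$) and such that $(\mathbb{L};C,\prec)$ is homogeneous. A function $e$ has behavior $\mathrm{nil}$ on $\mathbb{L}$ if for all $x\prec y\prec z$ we have $e(x)e(y)|e(z)$. For $k\geq2$, $\mathrm{Nil}(a_1,\dots,a_k)$ means $a_1\prec\dots\prec a_k$ and $a_1\dots a_{i-1}|a_i$ for all $i\in\{2,\dots,k\}$. For $F\subseteq\mathbb{L}^{\mathbb{L}}$,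 $\langle F\rangle$ is the set of all finite compositions of members of $F$ (including the identity). -}

module Defs where

open import Data.Nat using (ℕ; suc)
open import Data.Fin using (Fin; _<_)
open import Data.Product using (Σ; ∃; _×_)
open import Data.Sum using (_⊎_)
open import Data.Empty using (⊥)
open import Data.Unit using (⊤)
open import Relation.Nullary using (¬_)
open import Relation.Binary.PropositionalEquality using (_≡_)
open import Relation.Binary using (IsStrictTotalOrder)
open import Function using (_∘_; id; _⇔_; _⤖_)
open import Function.Bundles using (Bijection)
open import Function.Definitions using (Injective; Surjective)

data Tree : Set where
  leaf : Tree
  node : Tree → Tree → Tree

data Leaf : Tree → Set where
  here  : Leaf leaf
  left  : ∀ {l r} → Leaf l → Leaf (node l r)
  right : ∀ {l r} → Leaf r → Leaf (node l r)

-- CT T x y z  is  C(x;yz): the youngest common ancestor of y,z is a proper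
-- descendant of the youngest common ancestor of x,y,z.
CT : (T : Tree) → Leaf T → Leaf T → Leaf T → Set
CT (node l r) (left x)  (left y)  (left z)  = CT l x y z
CT (node l r) (right x) (left y)  (left z)  = ⊤
CT (node l r) (left x)  (right y) (right z) = ⊤
CT (node l r) (right x) (right y) (right z) = CT r x y z
CT _ _ _ _ = ⊥

-- Notions for a ternary-relation structure (A; C), C x y z meaning C(x;yz)

module _ {A : Set} (C : A → A → A → Set) where

  IsAut : (A → A) → Set
  IsAut f = Injective _≡_ _≡_ f × Surjective _≡_ _≡_ f
          × (∀ x y z → (C x y z ⇔ C (f x) (f y) (f z)))

  IsoToLeafStructure : ∀ {n} → (Fin n → A) → Tree → Set
  IsoToLeafStructure {n} f T =
    Σ (Fin n ⤖ Leaf T) λ φ → let g = Bijection.to φ in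
      ∀ i j k → (C (f i) (f j) (f k) ⇔ CT T (g i) (g j) (g k))

  -- age of (A;C) = leaf structures of finite rooted binary trees
  -- (finite substructures are nonempty)
  AgeIsBinaryTrees : Set
  AgeIsBinaryTrees =
      (∀ n (f : Fin (suc n) → A) → Injective _≡_ _≡_ f →
         ∃ λ T → IsoToLeafStructure f T)
    × (∀ T → Σ (Leaf T → A) λ g → Injective _≡_ _≡_ g ×
         (∀ x y z → (C (g x) (g y) (g z) ⇔ CT T x y z)))

  Homogeneous : Set
  Homogeneous = ∀ n (f g : Fin n → A) →
    Injective _≡_ _≡_ f → Injective _≡_ _≡_ g →
    (∀ i j k → (C (f i) (f j) (f k) ⇔ C (g i) (g j) (g k))) →
    Σ (A → A) λ α → IsAut α × (∀ i → α (f i) ≡ g i)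

  Countable : Set
  Countable = Σ (A → ℕ) (Injective _≡_ _≡_)

  -- (A; C) is (a copy of) 𝕃: countable homogeneous with the right age
  IsL : Set
  IsL = Countable × Homogeneous × AgeIsBinaryTrees

  module _ (_≺_ : A → A → Set) where

    Convex : Set
    Convex = ∀ x y z → C z x y → ¬ (x ≺ z × z ≺ y)

    HomogeneousOrd : Set
    HomogeneousOrd = ∀ n (f g : Fin n → A) →
      Injective _≡_ _≡_ f → Injective _≡_ _≡_ g →
      (∀ i j k → (C (f i) (f j) (f k) ⇔ C (g i) (g j) (g k))) →
      (∀ i j → (f i ≺ f j ⇔ g i ≺ g j)) →
      Σ (A → A) λ α → IsAut α × (∀ x y → (x ≺ y ⇔ α x ≺ α y))
                    × (∀ i → α (f i) ≡ g i)

    IsConvexHomogeneousOrder : Set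
    IsConvexHomogeneousOrder =
      IsStrictTotalOrder _≡_ _≺_ × Convex × HomogeneousOrd

    PreservesOrder : (A → A) → Set
    PreservesOrder e = ∀ x y → x ≺ y → e x ≺ e y

    BehaviorNil : (A → A) → Set
    BehaviorNil e = ∀ x y z → x ≺ y → y ≺ z → C (e z) (e x) (e y)

    -- Nil(a₁,…,a_k) (the side condition k ≥ 2 is imposed where used)
    Nil : ∀ {k} → (Fin k → A) → Set
    Nil {k} a = (∀ i j → i < j → a i ≺ a j)
              × (∀ i j j′ → j < i → j′ < i → C (a i) (a j) (a j′))

  data Generated (F : (A → A) → Set) : (A → A) → Set where
    gen-id   : Generated F id
    gen-comp : ∀ {f g} → F f → Generated F g → Generated F (f ∘ g)

  AutOr : (A → A) → (A → A) → Set
  AutOr e f = IsAut f ⊎ f ≡ e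

-- The permutations δ that are realised, for all Nil-tuples x and y, by some e ∈ ⟨Aut ∪ {nil}⟩
-- with e(xᵢ) = y_δ(i) are closed under composition, and every permutation is a composite of
-- maps moving one index m to the front; so it suffices to realise such a move. All injective
-- caterpillars of one length are isomorphic, so by homogeneity an automorphism α sends x to
-- any caterpillar z. Choose z so that zₘ is its least point and the other points increase:
-- then nil, applied to z listed in increasing order, yields a Nil-tuple, which a second
-- automorphism β sends to y, and e = β ∘ nil ∘ α. Such a z exists because by convexity every
-- embedded binary tree splits into a lower and an upper half, so reading a caterpillar off an
-- embedded perfect binary tree one may place each new point above or below all earlier ones.

module Submission where

open import Defs
open import Data.Nat using (ℕ; _≤_)
open import Data.Fin using (Fin)
open import Data.Fin.Permutation using (Permutation′; _⟨$⟩ʳ_)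
open import Data.Product using (Σ; _×_)
open import Relation.Binary.PropositionalEquality using (_≡_)

open import Data.Nat using (zero; suc; s≤s; s<s)
open import Data.Nat.Properties using (∸-monoʳ-<; <⇒≤)
open import Data.Fin using (zero; suc; _<_; lift; opposite; punchIn; punchOut; _≟_)
open import Data.Fin.Patterns using (0F; 1F; 2F)
open import Data.Fin.Properties
  using (<-cmp; <-trans; <-irrefl; ≤∧≢⇒<; toℕ<n; opposite-prop; opposite-involutive;
         punchIn-mono-≤; punchIn-injective; punchInᵢ≢i; punchOut-cong; punchIn-punchOut)
open import Data.Fin.Permutation
  using (_⟨$⟩ˡ_; insert; remove; inverseˡ; inverseʳ; punchIn-permute′)
import Data.Fin.Permutation as Permutation
open import Data.Vec.Functional using (_∷_; [])
open import Data.Product using (∃; _,_; proj₁; proj₂)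
open import Data.Sum using (_⊎_; inj₁; inj₂)
open import Data.Unit using (tt)
open import Data.Empty using (⊥-elim)
open import Function using (_∘_; id; _⇔_; mk⇔; Equivalence)
open import Function.Bundles using (Bijection)
open import Function.Definitions using (Injective)
open import Relation.Nullary using (¬_; yes; no)
open import Relation.Binary using (IsStrictTotalOrder; DecidableEquality; Irreflexive; tri<; tri≈; tri>)
open import Relation.Binary.PropositionalEquality
  using (_≢_; _≗_; refl; sym; trans; cong; subst; module ≡-Reasoning)

private variable n : ℕ

punchIn-mono-< : ∀ (m : Fin (suc n)) {i j} → i < j → punchIn m i < punchIn m j
punchIn-mono-< m {i} {j} i<j =
  ≤∧≢⇒< (punchIn-mono-≤ m i j (<⇒≤ i<j)) (λ e → <-irrefl (punchIn-injective m i j e) i<j)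

opposite-< : ∀ {i j : Fin n} → i < j → opposite j < opposite i
opposite-< {i = i} {j} i<j rewrite opposite-prop i | opposite-prop j = ∸-monoʳ-< (s<s i<j) (toℕ<n j)

∷-injective : ∀ {A : Set} {x : A} {xs : Fin n → A} →
  (∀ i → x ≢ xs i) → Injective _≡_ _≡_ xs → Injective _≡_ _≡_ (x ∷ xs)
∷-injective x∉xs inj {zero}  {zero}  _ = refl
∷-injective x∉xs inj {zero}  {suc j} e = ⊥-elim (x∉xs j e)
∷-injective x∉xs inj {suc i} {zero}  e = ⊥-elim (x∉xs i (sym e))
∷-injective x∉xs inj {suc i} {suc j} e = cong suc (inj e)

-- Permutations as composites of move-to-front maps

moveToFront : Fin (suc n) → Permutation′ (suc n)
moveToFront m = insert m 0F Permutation.id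

lift-moveToFront : ∀ (m : Fin (suc n)) i →
  lift 1 (moveToFront m ⟨$⟩ʳ_) i ≡ moveToFront 1F ⟨$⟩ʳ (moveToFront (suc m) ⟨$⟩ʳ i)
lift-moveToFront m zero = refl
lift-moveToFront m (suc i) with m ≟ i
... | yes refl = refl
... | no m≢i = cong (λ j → suc (suc j)) (punchOut-cong m refl)

moveToFront-decomposition : ∀ (π : Permutation′ (suc n)) i → let m = π ⟨$⟩ˡ 0F in
  π ⟨$⟩ʳ i ≡ lift 1 (remove m π ⟨$⟩ʳ_) (moveToFront m ⟨$⟩ʳ i)
moveToFront-decomposition π i with π ⟨$⟩ˡ 0F ≟ i
... | yes refl = inverseʳ π
... | no m≢i = begin
  π ⟨$⟩ʳ i                                     ≡⟨ cong (π ⟨$⟩ʳ_) (punchIn-punchOut m≢i) ⟨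
  π ⟨$⟩ʳ punchIn (π ⟨$⟩ˡ 0F) (punchOut m≢i)    ≡⟨ punchIn-permute′ π 0F (punchOut m≢i) ⟩
  suc (remove (π ⟨$⟩ˡ 0F) π ⟨$⟩ʳ punchOut m≢i) ∎
  where open ≡-Reasoning

data MoveComposite {n} : (Fin (suc n) → Fin (suc n)) → Set where
  move   : ∀ m → MoveComposite (moveToFront m ⟨$⟩ʳ_)
  _∘ᵐ_   : ∀ {f g} → MoveComposite f → MoveComposite g → MoveComposite (f ∘ g)
  ≗-resp : ∀ {f g} → f ≗ g → MoveComposite f → MoveComposite g

lift-∘ : ∀ (f g : Fin n → Fin n) → lift 1 f ∘ lift 1 g ≗ lift 1 (f ∘ g)
lift-∘ f g zero    = refl
lift-∘ f g (suc i) = refl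

lift-cong : ∀ {f g : Fin n → Fin n} → f ≗ g → lift 1 f ≗ lift 1 g
lift-cong f≗g zero    = refl
lift-cong f≗g (suc i) = cong suc (f≗g i)

lift-moveComposite : ∀ {f : Fin (suc n) → Fin (suc n)} → MoveComposite f → MoveComposite (lift 1 f)
lift-moveComposite (move m)       = ≗-resp (sym ∘ lift-moveToFront m) (move 1F ∘ᵐ move (suc m))
lift-moveComposite (c ∘ᵐ d)       = ≗-resp (lift-∘ _ _) (lift-moveComposite c ∘ᵐ lift-moveComposite d)
lift-moveComposite (≗-resp f≗g c) = ≗-resp (lift-cong f≗g) (lift-moveComposite c)

permutation-moveComposite : ∀ n (π : Permutation′ (suc n)) → MoveComposite (π ⟨$⟩ʳ_)
permutation-moveComposite zero π = ≗-resp (λ { 0F → Fin1-unique _ _ }) (move 0F)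
  where
  Fin1-unique : (i j : Fin 1) → i ≡ j
  Fin1-unique 0F 0F = refl
permutation-moveComposite (suc n) π =
  ≗-resp (sym ∘ moveToFront-decomposition π)
    (lift-moveComposite (permutation-moveComposite n (remove m π)) ∘ᵐ move m)
  where m = π ⟨$⟩ˡ 0F

-- Leaf structures

perfectTree : ℕ → Tree
perfectTree zero    = leaf
perfectTree (suc d) = node (perfectTree d) (perfectTree d)

someLeaf : ∀ T → Leaf T
someLeaf leaf       = here
someLeaf (node l r) = left (someLeaf l)

left≢right : ∀ {l r} {a : Leaf l} {b : Leaf r} → left a ≢ right b
left≢right ()

CT-irrefl : ∀ {T} (a b : Leaf T) → ¬ CT T a a b
CT-irrefl here      here      ()
CT-irrefl (left a)  (left b)  h = CT-irrefl a b h
CT-irrefl (right a) (right b) h = CT-irrefl a b h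
CT-irrefl (left a)  (right b) ()
CT-irrefl (right a) (left b)  ()

CT-swap : ∀ {T} (a b c : Leaf T) → CT T a b c → CT T a c b
CT-swap (left a)  (left b)  (left c)  h = CT-swap a b c h
CT-swap (right a) (right b) (right c) h = CT-swap a b c h
CT-swap (right a) (left b)  (left c)  h = tt
CT-swap (left a)  (right b) (right c) h = tt

CT-asym : ∀ {T} (a b c : Leaf T) → CT T a b c → ¬ CT T b a c
CT-asym (left a)  (left b)  (left c)  h h′ = CT-asym a b c h h′
CT-asym (right a) (right b) (right c) h h′ = CT-asym a b c h h′
CT-asym (left a)  (left b)  (right c) ()
CT-asym (left a)  (right b) (right c) h ()
CT-asym (right a) (left b)  (left c)  h ()
CT-asym (right a) (right b) (left c)  ()

CT-diag : ∀ {T} (a b : Leaf T) → a ≢ b → CT T a b b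
CT-diag here      here      a≢b = a≢b refl
CT-diag (left a)  (left b)  a≢b = CT-diag a b (a≢b ∘ cong left)
CT-diag (right a) (right b) a≢b = CT-diag a b (a≢b ∘ cong right)
CT-diag (left a)  (right b) _   = tt
CT-diag (right a) (left b)  _   = tt

swapRoot : ∀ {T} → Leaf (node T T) → Leaf (node T T)
swapRoot (left a)  = right a
swapRoot (right a) = left a

swapRoot-injective : ∀ {T} → Injective _≡_ _≡_ (swapRoot {T})
swapRoot-injective {x = left a}  {left b}  refl = refl
swapRoot-injective {x = right a} {right b} refl = refl

swapRoot-CT : ∀ {T} (a b c : Leaf (node T T)) →
  CT _ a b c → CT _ (swapRoot a) (swapRoot b) (swapRoot c)
swapRoot-CT (left a)  (left b)  (left c)  h = h
swapRoot-CT (right a) (right b) (right c) h = h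
swapRoot-CT (right a) (left b)  (left c)  h = tt
swapRoot-CT (left a)  (right b) (right c) h = tt

data Side : Set where
  below above : Side

flipSide : Side → Side
flipSide below = above
flipSide above = below

-- Once a node is oriented (see ConvexOrder.oriented), its left half is the lower one.
halfOn : ∀ {T} → Side → Leaf T → Leaf (node T T)
halfOn below = left
halfOn above = right

halfOn-CT : ∀ {T} t (a b c : Leaf T) → CT _ (halfOn t a) (halfOn (flipSide t) b) (halfOn (flipSide t) c)
halfOn-CT below a b c = tt
halfOn-CT above a b c = tt

frontSide : Fin n → Fin n → Side
frontSide m i with m ≟ i
... | yes _ = below
... | no _  = above

CaterpillarRelation : Fin n → Fin n → Fin n → Set
CaterpillarRelation i j k = i ≢ j × i ≢ k × (j ≡ k ⊎ (j < i × k < i))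

module _ {A : Set} (C : A → A → A → Set) where

  IsEmbedding : ∀ {T} → (Leaf T → A) → Set
  IsEmbedding {T} g = Injective _≡_ _≡_ g × (∀ a b c → CT T a b c → C (g a) (g b) (g c))

  embedding-halfOn : ∀ {T} {g : Leaf (node T T) → A} t → IsEmbedding g → IsEmbedding (g ∘ halfOn t)
  embedding-halfOn below (g-inj , g-CT) =
    (λ e → left-injective (g-inj e)) , λ a b c → g-CT (left a) (left b) (left c)
    where
    left-injective : ∀ {l r} {a b : Leaf l} → left {r = r} a ≡ left b → a ≡ b
    left-injective refl = refl
  embedding-halfOn above (g-inj , g-CT) =
    (λ e → right-injective (g-inj e)) , λ a b c → g-CT (right a) (right b) (right c)
    where
    right-injective : ∀ {l r} {a b : Leaf r} → right {l = l} a ≡ right b → a ≡ b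
    right-injective refl = refl

  Caterpillar : (Fin n → A) → Set
  Caterpillar a = ∀ i j j′ → j < i → j′ < i → C (a i) (a j) (a j′)

  ReversedCaterpillar : (Fin n → A) → Set
  ReversedCaterpillar a = ∀ i j j′ → i < j → i < j′ → C (a i) (a j) (a j′)

  reversed-opposite : (a : Fin n → A) → ReversedCaterpillar a → Caterpillar (a ∘ opposite)
  reversed-opposite a rc i j j′ j<i j′<i =
    rc (opposite i) (opposite j) (opposite j′) (opposite-< j<i) (opposite-< j′<i)

module LeafAxioms {A : Set} (C : A → A → A → Set) (_≟ᴬ_ : DecidableEquality A)
  (age : ∀ n (f : Fin (suc n) → A) → Injective _≡_ _≡_ f → ∃ λ T → IsoToLeafStructure C f T)
  where

  private
    leafImage : (f : Fin (suc n) → A) → Injective _≡_ _≡_ f →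
      Σ Tree λ T → Σ (Fin (suc n) → Leaf T) λ g → Injective _≡_ _≡_ g ×
        (∀ i j k → C (f i) (f j) (f k) ⇔ CT T (g i) (g j) (g k))
    leafImage f inj with age _ f inj
    ... | T , φ , iso = T , Bijection.to φ , Bijection.injective φ , iso

    single : A → Fin 1 → A
    single x = x ∷ []

    pair : A → A → Fin 2 → A
    pair x y = x ∷ y ∷ []

    triple : A → A → A → Fin 3 → A
    triple x y z = x ∷ y ∷ z ∷ []

    single-injective : ∀ x → Injective _≡_ _≡_ (single x)
    single-injective x = ∷-injective (λ ()) (λ {})

    pair-injective : ∀ {x y} → x ≢ y → Injective _≡_ _≡_ (pair x y)
    pair-injective x≢y = ∷-injective (λ { 0F → x≢y }) (single-injective _)

    triple-injective : ∀ {x y z} → x ≢ y → x ≢ z → y ≢ z → Injective _≡_ _≡_ (triple x y z)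
    triple-injective x≢y x≢z y≢z = ∷-injective (λ { 0F → x≢y ; 1F → x≢z }) (pair-injective y≢z)

  C-irrefl : ∀ {x y} → ¬ C x x y
  C-irrefl {x} {y} h with x ≟ᴬ y
  ... | yes refl with leafImage (single x) (single-injective x)
  ...   | _ , g , _ , iso = CT-irrefl (g 0F) (g 0F) (Equivalence.to (iso 0F 0F 0F) h)
  C-irrefl {x} {y} h | no x≢y with leafImage (pair x y) (pair-injective x≢y)
  ...   | _ , g , _ , iso = CT-irrefl (g 0F) (g 1F) (Equivalence.to (iso 0F 0F 1F) h)

  C-swap : ∀ {x y z} → C x y z → C x z y
  C-swap {x} {y} {z} h with y ≟ᴬ z | x ≟ᴬ y | x ≟ᴬ z
  ... | yes refl | _        | _        = h
  ... | no _     | yes refl | _        = ⊥-elim (C-irrefl h)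
  ... | no _     | no x≢y   | yes refl with leafImage (pair x y) (pair-injective x≢y)
  ...   | _ , g , _ , iso = Equivalence.from (iso 0F 0F 1F)
          (CT-swap (g 0F) (g 1F) (g 0F) (Equivalence.to (iso 0F 1F 0F) h))
  C-swap {x} {y} {z} h | no y≢z | no x≢y | no x≢z
    with leafImage (triple x y z) (triple-injective x≢y x≢z y≢z)
  ...   | _ , g , _ , iso = Equivalence.from (iso 0F 2F 1F)
          (CT-swap (g 0F) (g 1F) (g 2F) (Equivalence.to (iso 0F 1F 2F) h))

  C-asym : ∀ {x y z} → C x y z → ¬ C y x z
  C-asym {x} {y} {z} h h′ with x ≟ᴬ y | x ≟ᴬ z | y ≟ᴬ z
  ... | yes refl | _        | _        = C-irrefl h
  ... | no _     | yes refl | _        = C-irrefl (C-swap h)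
  ... | no _     | no _     | yes refl = C-irrefl (C-swap h′)
  ... | no x≢y   | no x≢z   | no y≢z
    with leafImage (triple x y z) (triple-injective x≢y x≢z y≢z)
  ...   | _ , g , _ , iso = CT-asym (g 0F) (g 1F) (g 2F)
          (Equivalence.to (iso 0F 1F 2F) h) (Equivalence.to (iso 1F 0F 2F) h′)

  C-diag : ∀ {x y} → x ≢ y → C x y y
  C-diag {x} {y} x≢y with leafImage (pair x y) (pair-injective x≢y)
  ... | _ , g , g-inj , iso = Equivalence.from (iso 0F 1F 1F)
          (CT-diag (g 0F) (g 1F) (λ e → x≢y (cong (pair x y) (g-inj e))))

  caterpillar-C⇒ : (a : Fin n → A) → Caterpillar C a →
    ∀ i j k → C (a i) (a j) (a k) → CaterpillarRelation i j k
  caterpillar-C⇒ a cat i j k h = (λ { refl → C-irrefl h }) , (λ { refl → C-irrefl (C-swap h) }) , lower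
    where
    below-both : ∀ {j k} → C (a i) (a j) (a k) → j < k → j < i × k < i
    below-both {j} {k} h j<k with <-cmp k i
    ... | tri< k<i _ _ = <-trans j<k k<i , k<i
    ... | tri≈ _ refl _ = ⊥-elim (C-irrefl (C-swap h))
    ... | tri> _ _ i<k = ⊥-elim (C-asym (C-swap h) (cat k i j i<k j<k))
    lower : j ≡ k ⊎ (j < i × k < i)
    lower with <-cmp j k
    ... | tri< j<k _ _ = inj₂ (below-both h j<k)
    ... | tri≈ _ j≡k _ = inj₁ j≡k
    ... | tri> _ _ k<j with below-both (C-swap h) k<j
    ...   | k<i , j<i = inj₂ (j<i , k<i)

  caterpillar-C⇐ : (a : Fin n → A) → Injective _≡_ _≡_ a → Caterpillar C a →
    ∀ i j k → CaterpillarRelation i j k → C (a i) (a j) (a k)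
  caterpillar-C⇐ a a-inj cat i j .j (i≢j , _ , inj₁ refl) = C-diag (i≢j ∘ a-inj)
  caterpillar-C⇐ a a-inj cat i j k (_ , _ , inj₂ (j<i , k<i)) = cat i j k j<i k<i

  caterpillars-isomorphic : (a b : Fin n → A) →
    Injective _≡_ _≡_ a → Injective _≡_ _≡_ b → Caterpillar C a → Caterpillar C b →
    ∀ i j k → C (a i) (a j) (a k) ⇔ C (b i) (b j) (b k)
  caterpillars-isomorphic a b a-inj b-inj a-cat b-cat i j k = mk⇔
    (caterpillar-C⇐ b b-inj b-cat i j k ∘ caterpillar-C⇒ a a-cat i j k)
    (caterpillar-C⇐ a a-inj a-cat i j k ∘ caterpillar-C⇒ b b-cat i j k)

-- Convex orders

module Ordered {A : Set} (_≺_ : A → A → Set) (≺-irrefl : Irreflexive _≡_ _≺_) where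

  Increasing : (Fin n → A) → Set
  Increasing u = ∀ i j → i < j → u i ≺ u j

  increasing-injective : (u : Fin n → A) → Increasing u → Injective _≡_ _≡_ u
  increasing-injective u u-inc {i} {j} ui≡uj with <-cmp i j
  ... | tri< i<j _ _ = ⊥-elim (≺-irrefl ui≡uj (u-inc i j i<j))
  ... | tri≈ _ i≡j _ = i≡j
  ... | tri> _ _ j<i = ⊥-elim (≺-irrefl (sym ui≡uj) (u-inc j i j<i))

  increasing-permuted-injective : (π : Permutation′ n) (z : Fin n → A) →
    Increasing (z ∘ (π ⟨$⟩ˡ_)) → Injective _≡_ _≡_ z
  increasing-permuted-injective π z u-inc {i} {j} zi≡zj = begin
    i                   ≡⟨ inverseˡ π ⟨
    π ⟨$⟩ˡ (π ⟨$⟩ʳ i)   ≡⟨ cong (π ⟨$⟩ˡ_) (increasing-injective _ u-inc u[πi]≡u[πj]) ⟩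
    π ⟨$⟩ˡ (π ⟨$⟩ʳ j)   ≡⟨ inverseˡ π ⟩
    j                   ∎
    where
    open ≡-Reasoning
    u[πi]≡u[πj] : z (π ⟨$⟩ˡ (π ⟨$⟩ʳ i)) ≡ z (π ⟨$⟩ˡ (π ⟨$⟩ʳ j))
    u[πi]≡u[πj] = trans (cong z (inverseˡ π)) (trans zi≡zj (cong z (sym (inverseˡ π))))

  OnSide : Side → A → A → Set
  OnSide below a b = a ≺ b
  OnSide above a b = b ≺ a

  frontSided-increasing : ∀ (m : Fin (suc n)) (z : Fin (suc n) → A) →
    (∀ i j → j < i → OnSide (frontSide m i) (z i) (z j)) → Increasing (z ∘ (moveToFront m ⟨$⟩ˡ_))
  frontSided-increasing m z sides = increasing
    where
    above-earlier : ∀ {i j} → j < i → m ≢ i → z j ≺ z i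
    above-earlier {i} {j} j<i m≢i with m ≟ i | sides i j j<i
    ... | yes m≡i | _     = ⊥-elim (m≢i m≡i)
    ... | no _    | zj≺zi = zj≺zi
    m-lowest : ∀ i → m ≢ i → z m ≺ z i
    m-lowest i m≢i with <-cmp m i | m ≟ m | sides m i
    ... | tri< m<i _ _ | _        | _     = above-earlier m<i m≢i
    ... | tri≈ _ m≡i _ | _        | _     = ⊥-elim (m≢i m≡i)
    ... | tri> _ _ i<m | yes _    | sides-m = sides-m i<m
    ... | tri> _ _ i<m | no m≢m   | _     = ⊥-elim (m≢m refl)
    increasing : Increasing (z ∘ (moveToFront m ⟨$⟩ˡ_))
    increasing 0F      (suc j) _         = m-lowest (punchIn m j) (punchInᵢ≢i m j ∘ sym)
    increasing (suc i) (suc j) (s≤s i<j) = above-earlier (punchIn-mono-< m i<j) (punchInᵢ≢i m j ∘ sym)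

module ConvexOrder {A : Set} (C : A → A → A → Set) (_≺_ : A → A → Set)
  (sto : IsStrictTotalOrder _≡_ _≺_) (convex : Convex C _≺_) where

  open IsStrictTotalOrder sto using (compare; irrefl)
  open Ordered _≺_ irrefl

  split-ordered : ∀ {P Q : Set} (p : P → A) (q : Q → A) →
    (∀ a a′ b → C (q b) (p a) (p a′)) → (∀ a b b′ → C (p a) (q b) (q b′)) →
    (∀ a b → p a ≢ q b) → ∀ {a₀ b₀} → p a₀ ≺ q b₀ → ∀ a b → p a ≺ q b
  split-ordered p q qpp pqq p≢q {a₀} {b₀} pa₀≺qb₀ = below-all
    where
    below-qb₀ : ∀ a → p a ≺ q b₀
    below-qb₀ a with compare (p a) (q b₀)
    ... | tri< pa≺qb₀ _ _ = pa≺qb₀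
    ... | tri≈ _ pa≡qb₀ _ = ⊥-elim (p≢q a b₀ pa≡qb₀)
    ... | tri> _ _ qb₀≺pa = ⊥-elim (convex (p a₀) (p a) (q b₀) (qpp a₀ a b₀) (pa₀≺qb₀ , qb₀≺pa))
    below-all : ∀ a b → p a ≺ q b
    below-all a b with compare (p a) (q b)
    ... | tri< pa≺qb _ _ = pa≺qb
    ... | tri≈ _ pa≡qb _ = ⊥-elim (p≢q a b pa≡qb)
    ... | tri> _ _ qb≺pa = ⊥-elim (convex (q b) (q b₀) (p a) (pqq a b b₀) (qb≺pa , below-qb₀ a))

  halves-ordered : ∀ {l r} (g : Leaf (node l r) → A) → IsEmbedding C g →
    (∀ a b → g (left a) ≺ g (right b)) ⊎ (∀ a b → g (right b) ≺ g (left a))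
  halves-ordered {l} {r} g (g-inj , g-CT) with compare (g (left (someLeaf l))) (g (right (someLeaf r)))
  ... | tri< l≺r _ _ = inj₁ (split-ordered (g ∘ left) (g ∘ right)
          (λ a a′ b → g-CT (right b) (left a) (left a′) tt)
          (λ a b b′ → g-CT (left a) (right b) (right b′) tt)
          (λ a b e → left≢right (g-inj e)) l≺r)
  ... | tri≈ _ l≡r _ = ⊥-elim (left≢right (g-inj l≡r))
  ... | tri> _ _ r≺l = inj₂ (λ a b → split-ordered (g ∘ right) (g ∘ left)
          (λ b b′ a → g-CT (left a) (right b) (right b′) tt)
          (λ b a a′ → g-CT (right b) (left a) (left a′) tt)
          (λ b a e → left≢right (g-inj (sym e))) r≺l b a)

  oriented : ∀ {T} (g : Leaf (node T T) → A) → IsEmbedding C g →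
    Σ (Leaf (node T T) → Leaf (node T T)) λ σ →
      IsEmbedding C (g ∘ σ) × (∀ a b → g (σ (left a)) ≺ g (σ (right b)))
  oriented g g-emb@(g-inj , g-CT) with halves-ordered g g-emb
  ... | inj₁ l≺r = id , g-emb , l≺r
  ... | inj₂ r≺l = swapRoot , (swapRoot-injective ∘ g-inj , λ a b c → g-CT _ _ _ ∘ swapRoot-CT a b c) ,
                   λ a b → r≺l b a

  -- The outermost point, index 0, is a leaf of the half on side s 0 of the oriented root;
  -- the other points are found recursively in the opposite half.
  sidedReversedCaterpillar : ∀ d (s : Fin (suc d) → Side)
    (g : Leaf (perfectTree d) → A) → IsEmbedding C g →
    Σ (Fin (suc d) → Leaf (perfectTree d)) λ ℓ →
      ReversedCaterpillar C (g ∘ ℓ) × (∀ i j → i < j → OnSide (s i) (g (ℓ i)) (g (ℓ j)))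
  sidedReversedCaterpillar zero s g _ = (λ _ → here) , (λ { 0F 0F _ () }) , λ { 0F 0F () }
  sidedReversedCaterpillar (suc d) s g g-emb with oriented g g-emb
  ... | σ , h-emb , l≺r
      with sidedReversedCaterpillar d (s ∘ suc) (g ∘ σ ∘ halfOn (flipSide (s 0F)))
             (embedding-halfOn C (flipSide (s 0F)) h-emb)
  ...   | ℓ , rc , sides = σ ∘ ℓ′ , caterpillar , sides′
    where
    h = g ∘ σ
    ℓ′ : Fin (suc (suc d)) → Leaf (perfectTree (suc d))
    ℓ′ = halfOn (s 0F) (someLeaf _) ∷ halfOn (flipSide (s 0F)) ∘ ℓ
    caterpillar : ReversedCaterpillar C (h ∘ ℓ′)
    caterpillar 0F      (suc j) (suc j′) _ _ = proj₂ h-emb _ _ _ (halfOn-CT (s 0F) _ _ _)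
    caterpillar (suc i) (suc j) (suc j′) (s≤s i<j) (s≤s i<j′) = rc i j j′ i<j i<j′
    outermost : ∀ t a → OnSide t (h (halfOn t (someLeaf _))) (h (halfOn (flipSide t) a))
    outermost below a = l≺r _ a
    outermost above a = l≺r a _
    sides′ : ∀ i j → i < j → OnSide (s i) (h (ℓ′ i)) (h (ℓ′ j))
    sides′ 0F      (suc j) _ = outermost (s 0F) (ℓ j)
    sides′ (suc i) (suc j) (s≤s i<j) = sides i j i<j

  sidedCaterpillar : ∀ d (t : Fin (suc d) → Side) (g : Leaf (perfectTree d) → A) → IsEmbedding C g →
    Σ (Fin (suc d) → A) λ z → Caterpillar C z × (∀ i j → j < i → OnSide (t i) (z i) (z j))
  sidedCaterpillar d t g g-emb with sidedReversedCaterpillar d (t ∘ opposite) g g-emb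
  ... | ℓ , rc , sides = g ∘ ℓ ∘ opposite , reversed-opposite C (g ∘ ℓ) rc , sides′
    where
    sides′ : ∀ i j → j < i → OnSide (t i) (g (ℓ (opposite i))) (g (ℓ (opposite j)))
    sides′ i j j<i =
      subst (λ k → OnSide (t k) (g (ℓ (opposite i))) (g (ℓ (opposite j)))) (opposite-involutive i)
        (sides (opposite i) (opposite j) (opposite-< j<i))

module Realisation (L : Set) (C : L → L → L → Set) (_≺_ : L → L → Set)
  (isL : IsL C) (ord : IsConvexHomogeneousOrder C _≺_)
  (nil : L → L) (nil-≺ : PreservesOrder C _≺_ nil) (nil-nil : BehaviorNil C _≺_ nil) where

  open IsStrictTotalOrder (proj₁ ord) using (irrefl) renaming (_≟_ to _≟ᴸ_)
  open LeafAxioms C _≟ᴸ_ (proj₁ (proj₂ (proj₂ isL)))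
  open Ordered _≺_ irrefl
  open ConvexOrder C _≺_ (proj₁ ord) (proj₁ (proj₂ ord))

  ⟨Aut∪nil⟩ : (L → L) → Set
  ⟨Aut∪nil⟩ = Generated C (AutOr C nil)

  ⟨Aut∪nil⟩-∘ : ∀ {f g} → ⟨Aut∪nil⟩ f → ⟨Aut∪nil⟩ g → ⟨Aut∪nil⟩ (f ∘ g)
  ⟨Aut∪nil⟩-∘ gen-id          g∈ = g∈
  ⟨Aut∪nil⟩-∘ (gen-comp a f∈) g∈ = gen-comp a (⟨Aut∪nil⟩-∘ f∈ g∈)

  automorphism∈ : ∀ {α} → IsAut C α → ⟨Aut∪nil⟩ α
  automorphism∈ α-aut = gen-comp (inj₁ α-aut) gen-id

  nil∈ : ⟨Aut∪nil⟩ nil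
  nil∈ = gen-comp (inj₂ refl) gen-id

  caterpillar-automorphism : (a b : Fin n → L) →
    Injective _≡_ _≡_ a → Injective _≡_ _≡_ b → Caterpillar C a → Caterpillar C b →
    Σ (L → L) λ α → IsAut C α × (∀ i → α (a i) ≡ b i)
  caterpillar-automorphism a b a-inj b-inj a-cat b-cat =
    proj₁ (proj₂ isL) _ a b a-inj b-inj (caterpillars-isomorphic a b a-inj b-inj a-cat b-cat)

  nil-Nil : (u : Fin n → L) → Increasing u → Nil C _≺_ (nil ∘ u)
  nil-Nil u u-inc = (λ i j i<j → nil-≺ _ _ (u-inc i j i<j)) , caterpillar
    where
    caterpillar : Caterpillar C (nil ∘ u)
    caterpillar i j j′ j<i j′<i with <-cmp j j′
    ... | tri< j<j′ _ _ = nil-nil (u j) (u j′) (u i) (u-inc j j′ j<j′) (u-inc j′ i j′<i)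
    ... | tri≈ _ refl _ = C-diag (λ e → irrefl (sym e) (nil-≺ _ _ (u-inc j i j<i)))
    ... | tri> _ _ j′<j = C-swap (nil-nil (u j′) (u j) (u i) (u-inc j′ j j′<j) (u-inc j i j<i))

  Realises : (Fin n → Fin n) → Set
  Realises f = ∀ x y → Nil C _≺_ x → Nil C _≺_ y →
    Σ (L → L) λ e → ⟨Aut∪nil⟩ e × (∀ i → e (x i) ≡ y (f i))

  realises-∘ : ∀ {f g : Fin n → Fin n} → Realises f → Realises g → Realises (f ∘ g)
  realises-∘ {g = g} f-real g-real x y x-nil y-nil with g-real x x x-nil x-nil | f-real x y x-nil y-nil
  ... | e₁ , e₁∈ , e₁x | e₂ , e₂∈ , e₂x =
    e₂ ∘ e₁ , ⟨Aut∪nil⟩-∘ e₂∈ e₁∈ , λ i → trans (cong e₂ (e₁x i)) (e₂x (g i))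

  realises-≗ : ∀ {f g : Fin n → Fin n} → f ≗ g → Realises f → Realises g
  realises-≗ f≗g f-real x y x-nil y-nil with f-real x y x-nil y-nil
  ... | e , e∈ , ex = e , e∈ , λ i → trans (ex i) (cong y (f≗g i))

  realises-sorting : (π : Permutation′ n) (z : Fin n → L) → Caterpillar C z →
    Increasing (z ∘ (π ⟨$⟩ˡ_)) → Realises (π ⟨$⟩ʳ_)
  realises-sorting π z z-cat u-inc x y (x-inc , x-cat) (y-inc , y-cat)
    with caterpillar-automorphism x z (increasing-injective x x-inc)
           (increasing-permuted-injective π z u-inc) x-cat z-cat
       | nil-Nil (z ∘ (π ⟨$⟩ˡ_)) u-inc
  ... | α , α-aut , αx≡z | nilu-inc , nilu-cat
    with caterpillar-automorphism (nil ∘ z ∘ (π ⟨$⟩ˡ_)) y (increasing-injective _ nilu-inc)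
           (increasing-injective y y-inc) nilu-cat y-cat
  ...   | β , β-aut , βnilu≡y =
    β ∘ nil ∘ α ,
    ⟨Aut∪nil⟩-∘ (automorphism∈ β-aut) (⟨Aut∪nil⟩-∘ nil∈ (automorphism∈ α-aut)) ,
    λ i → begin
      β (nil (α (x i)))                ≡⟨ cong (β ∘ nil) (αx≡z i) ⟩
      β (nil (z i))                    ≡⟨ cong (β ∘ nil ∘ z) (inverseˡ π) ⟨
      β (nil (z (π ⟨$⟩ˡ (π ⟨$⟩ʳ i))))  ≡⟨ βnilu≡y (π ⟨$⟩ʳ i) ⟩
      y (π ⟨$⟩ʳ i)                     ∎
    where open ≡-Reasoning

  realises-moveToFront : ∀ (m : Fin (suc n)) → Realises (moveToFront m ⟨$⟩ʳ_)
  realises-moveToFront {n} m with proj₂ (proj₂ (proj₂ isL)) (perfectTree n)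
  ... | g , g-inj , g-iso
      with sidedCaterpillar n (frontSide m) g (g-inj , λ a b c → Equivalence.from (g-iso a b c))
  ...   | z , z-cat , z-sides =
    realises-sorting (moveToFront m) z z-cat (frontSided-increasing m z z-sides)

  realises-moveComposite : ∀ {f : Fin (suc n) → Fin (suc n)} → MoveComposite f → Realises f
  realises-moveComposite (move m)       = realises-moveToFront m
  realises-moveComposite (c ∘ᵐ d)       = realises-∘ (realises-moveComposite c) (realises-moveComposite d)
  realises-moveComposite (≗-resp f≗g c) = realises-≗ f≗g (realises-moveComposite c)

mainTheorem6 : (L : Set) (C : L → L → L → Set) (_≺_ : L → L → Set) →
    IsL C → IsConvexHomogeneousOrder C _≺_ →
    (nil : L → L) → PreservesOrder C _≺_ nil → BehaviorNil C _≺_ nil →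
    (k : ℕ) → 2 ≤ k → (x y : Fin k → L) →
    Nil C _≺_ x → Nil C _≺_ y → (δ : Permutation′ k) →
    Σ (L → L) λ e → Generated C (AutOr C nil) e × (∀ i → e (x i) ≡ y (δ ⟨$⟩ʳ i))
mainTheorem6 _ _ _ _ _ _ _ _ zero () _ _ _ _ _
mainTheorem6 L C _≺_ isL ord nil nil-≺ nil-nil (suc n) _ x y x-nil y-nil δ =
  realises-moveComposite (permutation-moveComposite n δ) x y x-nil y-nil
  where open Realisation L C _≺_ isL ord nil nil-≺ nil-nil
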